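{- There exist process templates $A,B$ forming 1-conjunctive systems and an $\mathrm{LTL}\setminus\mathsf{X}$ formula $h(A,B_1)$ such that $(A,B)^{(1,1)} \not\models \mathsf{E}\, h(A,B_1)$ but $(A,B)^{(1,2)} \models \mathsf{E}\, h(A,B_1)$.
   Context: A process template is $U=(Q_U,\mathrm{init}_U,\Sigma_U,\delta_U)$ with finite state set $Q_U$ containing initial state $\mathrm{init}_U$, finite input alphabet $\Sigma_U$, and guarded transition relation $\delta_U \subseteq Q_U \times \Sigma_U \times \mathcal{P}(Q_A \cup Q_B) \times Q_U$. $Q_A,Q_B$ are disjoint, as are $\Sigma_A,\Sigma_B$. The system $(A,B)^{(1,n)}$ consists of one copy $A$ of template $A$ and $n$ copies $B_1,\dots,B_n$ of $B$ in interleaving composition, starting with all processes in their initial states. A local transition $(q,\sigma,g,q')$ of process $p$ is enabled in global state $s$ with global input $e$ if $s(p)=q$, $e(p)=\sigma$ and (conjunctive interpretation) every process $p'\neq p$ has $s(p')\in g$; $\mathrm{init}_A,\mathrm{init}_B$ belong to every guard. A conjunctive system is 1-conjunctive if every guard has the form $(Q_A\cup Q_B)\setminus\{q\}$ for some state $q$. Each global step moves exactly one process along an enabled local transition. A run is a maximal sequence of configurations $(s_t,e_t,p_t)$ from the initial state ($p_t$ the moving process; a $\bot$ configuration occurs exactly when all processes are disabled, ending the run), in which a process's input changes only when that process moves. $h(A,B_1)$ is an LTL formula without next-time over propositions from $Q_A\cup\Sigma_A$ and from $Q_B\cup\Sigma_B$ indexed by $B_1$; $(A,B)^{(1,n)}\models\mathsf{E}\,h$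 means some run satisfies $h$. -}

module Defs where

open import Data.Nat using (ℕ; zero; suc; _≤_; _<_)
open import Data.Fin using (Fin; zero; suc)
open import Data.Bool using (Bool; true; false)
open import Data.Sum using (_⊎_; inj₁; inj₂)
open import Data.Product using (Σ; Σ-syntax; ∃; ∃-syntax; _×_; _,_)
open import Data.Maybe using (Maybe; just; nothing)
open import Data.List using (List)
open import Data.List.Membership.Propositional using (_∈_)
open import Relation.Binary.PropositionalEquality using (_≡_; _≢_)
open import Relation.Nullary using (¬_)

-- State sets Q_A = Fin QA, Q_B = Fin QB (disjointness of Q_A, Q_B is
-- built in by using the disjoint union Fin QA ⊎ Fin QB); input alphabets
-- Σ_A = Fin SA, Σ_B = Fin SB (likewise kept disjoint by separate types).

GState : ℕ → ℕ → Set
GState QA QB = Fin QA ⊎ Fin QB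

Guard : ℕ → ℕ → Set
Guard QA QB = GState QA QB → Bool

record Templates : Set where
  field
    QA SA QB SB : ℕ
    initA : Fin QA
    initB : Fin QB
    δA : List (Fin QA × Fin SA × Guard QA QB × Fin QA)
    δB : List (Fin QB × Fin SB × Guard QA QB × Fin QB)

open Templates public

InitInGuards : Templates → Set
InitInGuards T =
  (∀ {q σ g q'} → (q , σ , g , q') ∈ δA T →
     g (inj₁ (initA T)) ≡ true × g (inj₂ (initB T)) ≡ true) ×
  (∀ {q σ g q'} → (q , σ , g , q') ∈ δB T →
     g (inj₁ (initA T)) ≡ true × g (inj₂ (initB T)) ≡ true)

IsOneConjGuard : ∀ {QA QB} → Guard QA QB → Set
IsOneConjGuard {QA} {QB} g =
  Σ[ r ∈ GState QA QB ] (∀ x → (g x ≡ true → x ≢ r) × (x ≢ r → g x ≡ true))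

OneConjunctive : Templates → Set
OneConjunctive T =
  (∀ {q σ g q'} → (q , σ , g , q') ∈ δA T → IsOneConjGuard g) ×
  (∀ {q σ g q'} → (q , σ , g , q') ∈ δB T → IsOneConjGuard g)

-- The system (A,B)^(1,n): one copy of A and n copies B_0..B_{n-1}
-- (B_1 of the paper is the copy with index zero).

data Proc (n : ℕ) : Set where
  pA : Proc n
  pB : Fin n → Proc n

module _ (T : Templates) (n : ℕ) where

  record Global : Set where
    constructor gl
    field
      sA : Fin (QA T)
      sB : Fin n → Fin (QB T)

  record Input : Set where
    constructor inp
    field
      eA : Fin (SA T)
      eB : Fin n → Fin (SB T)

  open Global
  open Input

  initial : Global
  initial = gl (initA T) (λ _ → initB T)

  Move : Proc n → Global → Input → Global → Set
  Move pA s e s' =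
    Σ[ q ∈ Fin (QA T) ] Σ[ σ ∈ Fin (SA T) ] Σ[ g ∈ Guard (QA T) (QB T) ] Σ[ q' ∈ Fin (QA T) ]
      ((q , σ , g , q') ∈ δA T × sA s ≡ q × eA e ≡ σ ×
       (∀ i → g (inj₂ (sB s i)) ≡ true) ×
       sA s' ≡ q' × (∀ i → sB s' i ≡ sB s i))
  Move (pB j) s e s' =
    Σ[ q ∈ Fin (QB T) ] Σ[ σ ∈ Fin (SB T) ] Σ[ g ∈ Guard (QA T) (QB T) ] Σ[ q' ∈ Fin (QB T) ]
      ((q , σ , g , q') ∈ δB T × sB s j ≡ q × eB e j ≡ σ ×
       g (inj₁ (sA s)) ≡ true × (∀ i → i ≢ j → g (inj₂ (sB s i)) ≡ true) ×
       sA s' ≡ sA s × sB s' j ≡ q' × (∀ i → i ≢ j → sB s' i ≡ sB s i))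

  Enabled : Proc n → Global → Input → Set
  Enabled p s e = ∃[ s' ] Move p s e s'

  InputFrame : Proc n → Input → Input → Set
  InputFrame pA e e' = ∀ i → eB e' i ≡ eB e i
  InputFrame (pB j) e e' = eA e' ≡ eA e × (∀ i → i ≢ j → eB e' i ≡ eB e i)

  SameGlobal : Global → Global → Set
  SameGlobal s s' = sA s' ≡ sA s × (∀ i → sB s' i ≡ sB s i)

  SameInput : Input → Input → Set
  SameInput e e' = eA e' ≡ eA e × (∀ i → eB e' i ≡ eB e i)

  -- One step of a run from configuration t to t+1.  The moving-process
  -- component is 'nothing' (the ⊥ configuration) exactly when all
  -- processes are disabled; the run then ends, which we represent by
  -- stuttering the final ⊥ configuration forever.
  StepOK : Global → Input → Maybe (Proc n) → Global → Input → Maybe (Proc n) → Set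
  StepOK s e (just p) s' e' _ = Move p s e s' × InputFrame p e e'
  StepOK s e nothing s' e' m' =
    (∀ p → ¬ Enabled p s e) × SameGlobal s s' × SameInput e e' × m' ≡ nothing

  record Run : Set where
    field
      state : ℕ → Global
      input : ℕ → Input
      mover : ℕ → Maybe (Proc n)
      start : SameGlobal initial (state 0)
      steps : ∀ t → StepOK (state t) (input t) (mover t)
                           (state (suc t)) (input (suc t)) (mover (suc t))

open Global public
open Input public
open Run public

data Atom (T : Templates) : Set where
  stA : Fin (QA T) → Atom T
  inA : Fin (SA T) → Atom T
  stB₁ : Fin (QB T) → Atom T
  inB₁ : Fin (SB T) → Atom T

data LTLX (T : Templates) : Set where
  atom : Atom T → LTLX T
  ¬ₗ_ : LTLX T → LTLX T
  _∧ₗ_ : LTLX T → LTLX T → LTLX T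
  _Uₗ_ : LTLX T → LTLX T → LTLX T

SatAtom : ∀ {T m} → Run T (suc m) → ℕ → Atom T → Set
SatAtom ρ t (stA q) = sA (state ρ t) ≡ q
SatAtom ρ t (inA σ) = eA (input ρ t) ≡ σ
SatAtom ρ t (stB₁ q) = sB (state ρ t) zero ≡ q
SatAtom ρ t (inB₁ σ) = eB (input ρ t) zero ≡ σ

Sat : ∀ {T m} → Run T (suc m) → ℕ → LTLX T → Set
Sat ρ t (atom a) = SatAtom ρ t a
Sat ρ t (¬ₗ φ) = ¬ Sat ρ t φ
Sat ρ t (φ ∧ₗ ψ) = Sat ρ t φ × Sat ρ t ψ
Sat ρ t (φ Uₗ ψ) = Σ[ k ∈ ℕ ] (t ≤ k × Sat ρ k ψ × (∀ j → t ≤ j → j < k → Sat ρ j φ))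

SysSatE : (T : Templates) (m : ℕ) → LTLX T → Set
SysSatE T m h = Σ[ ρ ∈ Run T (suc m) ] Sat ρ 0 h

-- With a single copy of B, the initial configuration is not a deadlock (A may
-- fire), and every local transition moves its process out of its initial
-- state, so on every run of (A,B)^(1,1) the second configuration already
-- violates h = □ (A in a₀ ∧ B₁ in b₀). In (A,B)^(1,2) the self-loop of B at b₁
-- lets B₂ take every step of the run while A and B₁ stay idle.
module Submission where

open import Data.Bool using (true; not)
open import Data.Bool.Properties using (not-¬)
open import Data.Empty using (⊥-elim)
open import Data.Fin using (Fin; zero; suc)
import Data.Fin.Properties as Fin
open import Data.List using (_∷_; [])
open import Data.List.Membership.Propositional using (_∈_)
open import Data.List.Relation.Unary.Any using (here; there)
open import Data.Maybe using (just; nothing)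
open import Data.Nat using (ℕ; zero; suc; _≤_; z≤n)
open import Data.Product using (Σ-syntax; ∃-syntax; _×_; _,_; proj₁)
open import Data.Sum using (inj₁; inj₂)
import Data.Sum.Properties as Sum
open import Relation.Binary.Definitions using (DecidableEquality)
open import Relation.Binary.PropositionalEquality using (_≡_; _≢_; refl; sym; trans; cong)
open import Relation.Nullary using (¬_; does)
open import Relation.Nullary.Decidable using (dec-true; dec-false)

open import Defs

_≟ᴳ_ : ∀ {QA QB} → DecidableEquality (GState QA QB)
_≟ᴳ_ = Sum.≡-dec Fin._≟_ Fin._≟_

avoiding : ∀ {QA QB} → GState QA QB → Guard QA QB
avoiding r x = not (does (x ≟ᴳ r))

avoiding-isOneConjGuard : ∀ {QA QB} (r : GState QA QB) → IsOneConjGuard (avoiding r)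
avoiding-isOneConjGuard r = r , λ x → excluded x , admitted x
  where
  excluded : ∀ x → avoiding r x ≡ true → x ≢ r
  excluded x admits x≡r = not-¬ (sym (dec-true (x ≟ᴳ r) x≡r)) (sym admits)

  admitted : ∀ x → x ≢ r → avoiding r x ≡ true
  admitted x x≢r = cong not (dec-false (x ≟ᴳ r) x≢r)

tautology : ∀ {T} → LTLX T → LTLX T
tautology φ = ¬ₗ (φ ∧ₗ (¬ₗ φ))

□ : ∀ {T} → LTLX T → LTLX T
□ φ = ¬ₗ (tautology φ Uₗ (¬ₗ φ))

module _ {T : Templates} {m : ℕ} (ρ : Run T (suc m)) where

  □-intro : ∀ {t} φ → (∀ k → t ≤ k → Sat ρ k φ) → Sat ρ t (□ φ)
  □-intro φ holds (k , t≤k , fails , _) = fails (holds k t≤k)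

  □-violated : ∀ {t k} φ → t ≤ k → ¬ Sat ρ k φ → ¬ Sat ρ t (□ φ)
  □-violated φ t≤k fails always = always (_ , t≤k , fails , λ _ _ _ (holds , fails) → fails holds)

progress : ∀ {T n} (ρ : Run T n) t p → Enabled T n p (state ρ t) (input ρ t) →
           ∃[ p′ ] Move T n p′ (state ρ t) (input ρ t) (state ρ (suc t))
progress ρ t p enabled with mover ρ t | steps ρ t
... | just p′ | move , _ = p′ , move
... | nothing | disabled , _ = ⊥-elim (disabled p enabled)

a₀ a₁ b₀ b₁ : Fin 2
a₀ = zero
a₁ = suc zero
b₀ = zero
b₁ = suc zero

guard : Guard 2 2
guard = avoiding (inj₁ a₁)

templates : Templates
templates = record
  { QA = 2 ; SA = 1 ; QB = 2 ; SB = 1 ; initA = a₀ ; initB = b₀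
  ; δA = (a₀ , zero , guard , a₁) ∷ []
  ; δB = (b₀ , zero , guard , b₁) ∷ (b₁ , zero , guard , b₁) ∷ []
  }

guard-of-δA : ∀ {q σ g q′} → (q , σ , g , q′) ∈ δA templates → g ≡ guard
guard-of-δA (here refl) = refl

guard-of-δB : ∀ {q σ g q′} → (q , σ , g , q′) ∈ δB templates → g ≡ guard
guard-of-δB (here refl) = refl
guard-of-δB (there (here refl)) = refl

initInGuards : InitInGuards templates
initInGuards = (λ ∈δ → init∈ (guard-of-δA ∈δ)) , (λ ∈δ → init∈ (guard-of-δB ∈δ))
  where
  init∈ : ∀ {g} → g ≡ guard → g (inj₁ a₀) ≡ true × g (inj₂ b₀) ≡ true
  init∈ refl = refl , refl

oneConjunctive : OneConjunctive templates
oneConjunctive = (λ ∈δ → oneConj (guard-of-δA ∈δ)) , (λ ∈δ → oneConj (guard-of-δB ∈δ))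
  where
  oneConj : ∀ {g} → g ≡ guard → IsOneConjGuard g
  oneConj refl = avoiding-isOneConjGuard (inj₁ a₁)

A-enabled-at-a₀ : ∀ {n} s e → sA s ≡ a₀ → Enabled templates n pA s e
A-enabled-at-a₀ (gl _ sB) (inp zero _) atA₀ =
  gl a₁ sB , (a₀ , zero , guard , a₁ , here refl , atA₀ , refl , (λ _ → refl) , refl , λ _ → refl)

B-transition-to-b₁ : ∀ q → (q , zero , guard , b₁) ∈ δB templates
B-transition-to-b₁ zero = here refl
B-transition-to-b₁ (suc zero) = there (here refl)

idle : LTLX templates
idle = atom (stA a₀) ∧ₗ atom (stB₁ b₀)

idleForever : LTLX templates
idleForever = □ idle

move-leaves-idle : ∀ p {s e s′} → Move templates 1 p s e s′ → ¬ (sA s′ ≡ a₀ × sB s′ zero ≡ b₀)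
move-leaves-idle pA (_ , _ , _ , _ , here refl , _ , _ , _ , atA₁ , _) (atA₀ , _) =
  Fin.0≢1+n (trans (sym atA₀) atA₁)
move-leaves-idle (pB zero) (_ , _ , _ , _ , here refl , _ , _ , _ , _ , _ , atB₁ , _) (_ , atB₀) =
  Fin.0≢1+n (trans (sym atB₀) atB₁)
move-leaves-idle (pB zero) (_ , _ , _ , _ , there (here refl) , _ , _ , _ , _ , _ , atB₁ , _) (_ , atB₀) =
  Fin.0≢1+n (trans (sym atB₀) atB₁)

no-idleForever-run₁ : ¬ SysSatE templates 0 idleForever
no-idleForever-run₁ (ρ , always)
  with progress ρ 0 pA (A-enabled-at-a₀ (state ρ 0) (input ρ 0) (proj₁ (start ρ)))
... | p , move = □-violated ρ idle z≤n (move-leaves-idle p move) always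

B₂ : Fin 2
B₂ = suc zero

B₂-state : ℕ → Fin 2
B₂-state zero = b₀
B₂-state (suc _) = b₁

B-states : ℕ → Fin 2 → Fin 2
B-states _ zero = b₀
B-states t (suc zero) = B₂-state t

B₂-step : ∀ t → StepOK templates 2
  (gl a₀ (B-states t)) (inp zero λ _ → zero) (just (pB B₂))
  (gl a₀ (B-states (suc t))) (inp zero λ _ → zero) (just (pB B₂))
B₂-step t =
  (B₂-state t , zero , guard , b₁ , B-transition-to-b₁ (B₂-state t) ,
   refl , refl , refl , (λ _ _ → refl) , refl , refl , others-unchanged) ,
  refl , (λ _ _ → refl)
  where
  others-unchanged : ∀ i → i ≢ B₂ → B-states (suc t) i ≡ B-states t i
  others-unchanged zero _ = refl
  others-unchanged (suc zero) i≢B₂ = ⊥-elim (i≢B₂ refl)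

B₂-loop : Run templates 2
B₂-loop = record
  { state = λ t → gl a₀ (B-states t)
  ; input = λ _ → inp zero λ _ → zero
  ; mover = λ _ → just (pB B₂)
  ; start = refl , λ { zero → refl ; (suc zero) → refl }
  ; steps = B₂-step
  }

idleForever-run₂ : SysSatE templates 1 idleForever
idleForever-run₂ = B₂-loop , □-intro B₂-loop idle λ _ _ → refl , refl

mainTheorem10 : Σ[ T ∈ Templates ] (InitInGuards T × OneConjunctive T ×
                    Σ[ h ∈ LTLX T ] (¬ SysSatE T 0 h × SysSatE T 1 h))
mainTheorem10 =
  templates , initInGuards , oneConjunctive , idleForever ,
  no-idleForever-run₁ , idleForever-run₂
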